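{- Let $\mathbf{d}=(d_1,\dots,d_n)$ be a degree sequence with $\sum_{i=1}^n d_i=4(n-1)-2$, $n>4$, $d_1\le n-1$, $d_{n-1}\ge 2$ and $d_n\ge 1$. If $d_4\ge 3$, then $\mathbf{d}$ is graphical.
   Context: A degree sequence is a non-increasing sequence $d_1\ge\dots\ge d_n$ of non-negative integers; it is graphical if there is a simple graph on vertices $v_1,\dots,v_n$ with $\deg(v_i)=d_i$ for all $i$. -}

module Defs where

open import Data.Nat using (ℕ; zero; suc; _+_; _≤_; _<?_)
open import Data.Fin using (Fin; toℕ; fromℕ<)
open import Data.Fin.Properties using (_≟_)
open import Data.Bool using (Bool; true; false)
open import Data.List using (List; length; filter; map; allFin)
open import Data.Nat.ListAction using (sum)
open import Relation.Binary.PropositionalEquality using (_≡_)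
open import Relation.Nullary using (¬_; yes; no)
open import Data.Bool.Properties using () renaming (_≟_ to _≟ᵇ_)
open import Data.Product using (Σ; _×_)

-- A sequence of n natural numbers (vertices v_1..v_n are Fin n, 0-based).
Seq : ℕ → Set
Seq n = Fin n → ℕ

-- 1-based access d_i ; returns 0 outside 1..n (never used out of range).
infixl 9 _at_
_at_ : ∀ {n} → Seq n → ℕ → ℕ
_at_ {n} d zero = 0
_at_ {n} d (suc k) with k <? n
... | yes p = d (fromℕ< p)
... | no _  = 0

NonIncreasing : ∀ {n} → Seq n → Set
NonIncreasing {n} d = ∀ (i j : Fin n) → toℕ i ≤ toℕ j → d j ≤ d i

total : ∀ {n} → Seq n → ℕ
total {n} d = sum (map d (allFin n))

record SimpleGraph (n : ℕ) : Set where
  field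
    adj       : Fin n → Fin n → Bool
    symmetric : ∀ i j → adj i j ≡ adj j i
    loopless  : ∀ i → adj i i ≡ false

degree : ∀ {n} → SimpleGraph n → Fin n → ℕ
degree {n} G i = length (filter (λ j → SimpleGraph.adj G i j ≟ᵇ true) (allFin n))

Graphical : ∀ {n} → Seq n → Set
Graphical {n} d = Σ (SimpleGraph n) λ G → ∀ i → degree G i ≡ d i

{-# OPTIONS --safe #-}
module Submission where

-- The easy direction of Havel–Hakimi: if deleting a vertex of minimum degree k
-- and lowering the k largest other degrees by one leaves a graphical sequence,
-- then a new vertex joined to those k vertices realises the original one.
-- Sequences with minimum ≥ 2, maximum ≤ n − 1 and even sum ≤ 4n − 6 form a
-- class closed under this step.  The sum bound forces the minimum to be 2 or 3;
-- the (k+1)-st largest other degree stays below n − 1, for otherwise the k + 1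
-- largest degrees alone would exceed the sum bound; and a degree 2 would only drop
-- to 1 when all degrees but the largest are 2, and (2j, 2, …, 2) is realised by
-- j cycles through one vertex.  When d_n = 1 the pendant vertex goes to the
-- largest degree; the residual sum is then only ≤ 4n − 4, but at least four
-- degrees ≥ 3 survive, which again gives a class closed under the step (up to
-- returning to the first one).  Twice a bound 4n − 5 is improved to 4n − 6 by
-- parity.

open import Data.Bool using (Bool; true; false)
open import Data.Bool.Properties using () renaming (_≟_ to _≟ᵇ_)
open import Data.Empty using (⊥; ⊥-elim)
open import Data.Fin using (Fin; zero; suc; toℕ; cast; fromℕ<; inject₁)
open import Data.Fin.Permutation using (Permutation; _⟨$⟩ʳ_; cast-id)
open import Data.Fin.Properties using (cast-is-id; toℕ-fromℕ<; toℕ-inject₁; toℕ≤pred[n])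
open import Data.List using (List; []; _∷_; _++_; length; filter; tabulate; lookup; replicate)
open import Data.List.Properties
  using (length-tabulate; lookup-tabulate; map-tabulate; length-filter; filter-accept; filter-reject)
open import Data.List.Relation.Binary.Permutation.Homogeneous using (onIndices)
open import Data.List.Relation.Binary.Permutation.Propositional
  using (_↭_; ↭-sym; ↭⇒↭ₛ; prep; swap; ↭-refl; ↭-trans)
open import Data.List.Relation.Binary.Permutation.Propositional.Properties
  using (All-resp-↭; ↭-length; filter-↭)
open import Data.List.Relation.Binary.Permutation.Setoid.Properties using (onIndices-lookup)
open import Data.List.Relation.Unary.All as All using (All; []; _∷_)
open import Data.List.Relation.Unary.All.Properties using (tabulate⁺)
import Data.List.Relation.Unary.AllPairs as AllPairs
open import Data.List.Relation.Unary.Linked using (Linked; []; _∷_)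
open import Data.List.Relation.Unary.Linked.Properties using (Linked⇒AllPairs)
import Data.List.Sort
open import Data.Nat using (ℕ; zero; suc; _+_; _*_; _∸_; _≤_; _<_; _≥_; _<ᵇ_; _≤?_; _<?_; z≤n; s≤s)
open import Data.Nat.Divisibility using (_∣_; divides; divides-refl; ∣m+n∣m⇒∣n; ∣m∣n⇒∣m+n; ∣m⇒∣m*n)
open import Data.Nat.ListAction using (sum)
open import Data.Nat.ListAction.Properties using (sum-↭)
open import Data.Nat.Properties
open import Data.Nat.Tactic.RingSolver using (solve-∀)
open import Data.Product using (∃; _×_; _,_)
open import Function using (_∘_; id)
open import Relation.Binary.Properties.DecTotalOrder ≤-decTotalOrder using (≥-decTotalOrder)
open import Relation.Binary.PropositionalEquality
open import Relation.Nullary using (¬_; yes; no)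

open import Defs

import Algebra.Properties.CommutativeMonoid.Sum +-0-commutativeMonoid as ∑

-- Relabelling vertices and joining a new vertex

bit : Bool → ℕ
bit true  = 1
bit false = 0

count-true-tabulate : ∀ {m n} (f : Fin n → Bool) (g : Fin m → Fin n) →
  length (filter (λ j → f j ≟ᵇ true) (tabulate g)) ≡ ∑.sum (bit ∘ f ∘ g)
count-true-tabulate {zero}  f g = refl
count-true-tabulate {suc m} f g with f (g zero)
... | true  = cong suc (count-true-tabulate f (g ∘ suc))
... | false = count-true-tabulate f (g ∘ suc)

degree≡∑ : ∀ {n} (G : SimpleGraph n) i → degree G i ≡ ∑.sum (bit ∘ SimpleGraph.adj G i)
degree≡∑ G i = count-true-tabulate (SimpleGraph.adj G i) id

graphical-≗ : ∀ {n} {d e : Seq n} → (∀ i → d i ≡ e i) → Graphical d → Graphical e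
graphical-≗ d≗e (G , deg) = G , λ i → trans (deg i) (d≗e i)

relabel : ∀ {m n} {d : Seq m} (π : Permutation n m) → Graphical d → Graphical (d ∘ (π ⟨$⟩ʳ_))
relabel {d = d} π (G , deg) = G′ , deg′
  where
  open SimpleGraph G
  G′ : SimpleGraph _
  G′ = record
    { adj       = λ u v → adj (π ⟨$⟩ʳ u) (π ⟨$⟩ʳ v)
    ; symmetric = λ u v → symmetric (π ⟨$⟩ʳ u) (π ⟨$⟩ʳ v)
    ; loopless  = λ u → loopless (π ⟨$⟩ʳ u)
    }
  deg′ : ∀ u → degree G′ u ≡ d (π ⟨$⟩ʳ u)
  deg′ u = begin
    degree G′ u                                 ≡⟨ degree≡∑ G′ u ⟩
    ∑.sum (bit ∘ adj (π ⟨$⟩ʳ u) ∘ (π ⟨$⟩ʳ_))    ≡⟨ ∑.sum-permute (bit ∘ adj (π ⟨$⟩ʳ u)) π ⟨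
    ∑.sum (bit ∘ adj (π ⟨$⟩ʳ u))                ≡⟨ degree≡∑ G (π ⟨$⟩ʳ u) ⟨
    degree G (π ⟨$⟩ʳ u)                         ≡⟨ deg (π ⟨$⟩ʳ u) ⟩
    d (π ⟨$⟩ʳ u)                                ∎
    where open ≡-Reasoning

withVertex : ∀ {n} → Seq n → (Fin n → Bool) → Seq (suc n)
withVertex d N zero    = ∑.sum (bit ∘ N)
withVertex d N (suc i) = bit (N i) + d i

graphical-withVertex : ∀ {n} {d : Seq n} (N : Fin n → Bool) → Graphical d → Graphical (withVertex d N)
graphical-withVertex {n} {d} N (G , deg) = G′ , deg′
  where
  open SimpleGraph G
  adj′ : Fin (suc n) → Fin (suc n) → Bool
  adj′ zero    zero    = false
  adj′ zero    (suc j) = N j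
  adj′ (suc i) zero    = N i
  adj′ (suc i) (suc j) = adj i j
  symmetric′ : ∀ i j → adj′ i j ≡ adj′ j i
  symmetric′ zero    zero    = refl
  symmetric′ zero    (suc j) = refl
  symmetric′ (suc i) zero    = refl
  symmetric′ (suc i) (suc j) = symmetric i j
  loopless′ : ∀ i → adj′ i i ≡ false
  loopless′ zero    = refl
  loopless′ (suc i) = loopless i
  G′ : SimpleGraph (suc n)
  G′ = record { adj = adj′ ; symmetric = symmetric′ ; loopless = loopless′ }
  deg′ : ∀ i → degree G′ i ≡ withVertex d N i
  deg′ zero    = degree≡∑ G′ zero
  deg′ (suc i) = trans (degree≡∑ G′ (suc i)) (cong (bit (N i) +_) (trans (sym (degree≡∑ G i)) (deg i)))

GraphicalList : List ℕ → Set
GraphicalList xs = Graphical (lookup xs)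

graphical-[] : GraphicalList []
graphical-[] = record { adj = λ () ; symmetric = λ () ; loopless = λ () } , λ ()

graphical-↭ : ∀ {xs ys} → xs ↭ ys → GraphicalList xs → GraphicalList ys
graphical-↭ xs↭ys g = graphical-≗ (λ i → sym (onIndices-lookup (setoid ℕ) (↭⇒↭ₛ (↭-sym xs↭ys)) i))
  (relabel (onIndices (↭⇒↭ₛ (↭-sym xs↭ys))) g)

graphical-tabulate : ∀ {n} (d : Seq n) → GraphicalList (tabulate d) → Graphical d
graphical-tabulate d g =
  graphical-≗ (lookup-tabulate d) (relabel (cast-id (sym (length-tabulate d))) g)

incrementPrefix : ℕ → List ℕ → List ℕ
incrementPrefix zero    xs       = xs
incrementPrefix (suc k) []       = []
incrementPrefix (suc k) (x ∷ xs) = suc x ∷ incrementPrefix k xs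

length-incrementPrefix : ∀ k xs → length (incrementPrefix k xs) ≡ length xs
length-incrementPrefix zero    xs       = refl
length-incrementPrefix (suc k) []       = refl
length-incrementPrefix (suc k) (x ∷ xs) = cong suc (length-incrementPrefix k xs)

isPrefix : ℕ → ∀ {n} → Fin n → Bool
isPrefix k i = toℕ i <ᵇ k

∑-isPrefix : ∀ {n} k → k ≤ n → ∑.sum (bit ∘ isPrefix k {n}) ≡ k
∑-isPrefix {n}     zero    _         = ∑.sum-replicate-zero n
∑-isPrefix {suc n} (suc k) (s≤s k≤n) = cong suc (∑-isPrefix k k≤n)

lookup-incrementPrefix : ∀ k xs (i : Fin (length (incrementPrefix k xs))) →
  let j = cast (length-incrementPrefix k xs) i in
  lookup (incrementPrefix k xs) i ≡ bit (isPrefix k j) + lookup xs j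
lookup-incrementPrefix zero    xs       i       = cong (lookup xs) (sym (cast-is-id refl i))
lookup-incrementPrefix (suc k) (x ∷ xs) zero    = refl
lookup-incrementPrefix (suc k) (x ∷ xs) (suc i) = lookup-incrementPrefix k xs i

graphical-layOff : ∀ k xs → k ≤ length xs → GraphicalList xs → GraphicalList (k ∷ incrementPrefix k xs)
graphical-layOff k xs k≤n g =
  graphical-≗ joined (relabel (cast-id (cong suc (length-incrementPrefix k xs))) (graphical-withVertex (isPrefix k) g))
  where
  joined : ∀ i → withVertex (lookup xs) (isPrefix k) (cast (cong suc (length-incrementPrefix k xs)) i)
                 ≡ lookup (k ∷ incrementPrefix k xs) i
  joined zero    = ∑-isPrefix k k≤n
  joined (suc i) = sym (lookup-incrementPrefix k xs i)

graphical-path : ∀ p → GraphicalList (1 ∷ 1 ∷ replicate p 2)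
graphical-path zero    = graphical-layOff 1 (0 ∷ []) (s≤s z≤n) (graphical-layOff 0 [] z≤n graphical-[])
graphical-path (suc p) =
  graphical-↭ (prep 1 (swap 2 1 ↭-refl)) (graphical-layOff 1 (1 ∷ 1 ∷ replicate p 2) (s≤s z≤n) (graphical-path p))

graphical-cycle : ∀ p → GraphicalList (replicate (3 + p) 2)
graphical-cycle p = graphical-layOff 2 (1 ∷ 1 ∷ replicate p 2) (s≤s (s≤s z≤n)) (graphical-path p)

-- j + 1 cycles through a common centre; q counts the vertices beyond two per cycle
graphical-flower : ∀ j q → GraphicalList (suc j * 2 ∷ replicate (suc j * 2 + q) 2)
graphical-flower zero    q = graphical-cycle q
graphical-flower (suc j) q =
  graphical-↭ (↭-trans (prep 2 (swap 2 c ↭-refl)) (swap 2 c ↭-refl))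
    (graphical-layOff 2 (1 ∷ _ ∷ twos) (s≤s (s≤s z≤n))
      (graphical-layOff 1 (_ ∷ twos) (s≤s z≤n) (graphical-flower j q)))
  where
  twos : List ℕ
  twos = replicate (suc j * 2 + q) 2
  c : ℕ
  c = suc (suc j) * 2

graphical-even∷twos : ∀ {a t} → 2 ∣ a → 2 ≤ a → a ≤ t → GraphicalList (a ∷ replicate t 2)
graphical-even∷twos (divides-refl zero)    ()
graphical-even∷twos (divides-refl (suc j)) _ a≤t with m≤n⇒∃[o]m+o≡n a≤t
... | q , refl = graphical-flower j q

-- Lists of degrees

Descending : List ℕ → Set
Descending = Linked _≥_

descending-head : ∀ {x xs} → Descending (x ∷ xs) → All (_≤ x) xs
descending-head = AllPairs.head ∘ Linked⇒AllPairs (λ x≥y y≥z → ≤-trans y≥z x≥y)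

descending-all< : ∀ {m x xs} → Descending (x ∷ xs) → x < m → All (_< m) (x ∷ xs)
descending-all< x∷xs↘ x<m = x<m ∷ All.map (λ y≤x → ≤-<-trans y≤x x<m) (descending-head x∷xs↘)

descending-↭ : ∀ xs → ∃ λ ys → xs ↭ ys × Descending ys
descending-↭ xs = sort xs , ↭-sym (sort-↭ xs) , sort-↗ xs
  where open Data.List.Sort ≥-decTotalOrder

record MinFirst (xs : List ℕ) : Set where
  constructor minFirst
  field
    {min}      : ℕ
    {others}   : List ℕ
    ↭-min∷     : xs ↭ min ∷ others
    min≤others : All (min ≤_) others
    descending : Descending others

splitMin : ∀ x xs → MinFirst (x ∷ xs)
splitMin x xs with sort (x ∷ xs) | sort-↭ (x ∷ xs) | sort-↗ (x ∷ xs)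
  where open Data.List.Sort ≤-decTotalOrder
... | []     | sorted↭ | _ with () ← ↭-length sorted↭
... | k ∷ ys | sorted↭ | sorted with descending-↭ ys
...   | zs , ys↭zs , zs↘ = minFirst
  (↭-trans (↭-sym sorted↭) (prep k ys↭zs))
  (All-resp-↭ ys↭zs (AllPairs.head (Linked⇒AllPairs ≤-trans sorted)))
  zs↘

sum-≥ : ∀ {ℓ} xs → All (ℓ ≤_) xs → ℓ * length xs ≤ sum xs
sum-≥ {ℓ} []       []         = ≤-reflexive (*-zeroʳ ℓ)
sum-≥ {ℓ} (x ∷ xs) (ℓ≤x ∷ ℓ≤xs) = ≤-trans (≤-reflexive (*-suc ℓ (length xs))) (+-mono-≤ ℓ≤x (sum-≥ xs ℓ≤xs))

sum-≤ : ∀ {u} xs → All (_≤ u) xs → sum xs ≤ u * length xs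
sum-≤ {u} []       []         = z≤n
sum-≤ {u} (x ∷ xs) (x≤u ∷ xs≤u) = ≤-trans (+-mono-≤ x≤u (sum-≤ xs xs≤u)) (≤-reflexive (sym (*-suc u (length xs))))

sum-replicate : ∀ r v → sum (replicate r v) ≡ r * v
sum-replicate zero    v = refl
sum-replicate (suc r) v = cong (v +_) (sum-replicate r v)

≡replicate : ∀ {v} xs → All (v ≤_) xs → All (_≤ v) xs → xs ≡ replicate (length xs) v
≡replicate []       []           []           = refl
≡replicate (x ∷ xs) (v≤x ∷ v≤xs) (x≤v ∷ xs≤v) = cong₂ _∷_ (≤-antisym x≤v v≤x) (≡replicate xs v≤xs xs≤v)

count≥3 : List ℕ → ℕ
count≥3 xs = length (filter (3 ≤?_) xs)

count≥3-↭ : ∀ {xs ys} → xs ↭ ys → count≥3 xs ≡ count≥3 ys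
count≥3-↭ xs↭ys = ↭-length (filter-↭ (3 ≤?_) xs↭ys)

count≥3≤length : ∀ xs → count≥3 xs ≤ length xs
count≥3≤length = length-filter (3 ≤?_)

count≥3-accept : ∀ {x} xs → 3 ≤ x → count≥3 (x ∷ xs) ≡ suc (count≥3 xs)
count≥3-accept xs 3≤x = cong length (filter-accept (3 ≤?_) 3≤x)

count≥3-reject : ∀ {x} xs → ¬ 3 ≤ x → count≥3 (x ∷ xs) ≡ count≥3 xs
count≥3-reject xs 3≰x = cong length (filter-reject (3 ≤?_) 3≰x)

count≥3-∷≤ : ∀ x xs → count≥3 (x ∷ xs) ≤ suc (count≥3 xs)
count≥3-∷≤ x xs with 3 ≤? x
... | yes 3≤x = ≤-reflexive (count≥3-accept xs 3≤x)
... | no  3≰x = ≤-trans (≤-reflexive (count≥3-reject xs 3≰x)) (n≤1+n _)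

count≥3-≤2 : ∀ xs → All (_≤ 2) xs → count≥3 xs ≡ 0
count≥3-≤2 []       []           = refl
count≥3-≤2 (x ∷ xs) (x≤2 ∷ xs≤2) = trans (count≥3-reject xs (≤⇒≯ x≤2)) (count≥3-≤2 xs xs≤2)

count≥3-++≤ : ∀ xs ys → count≥3 (xs ++ ys) ≤ length xs + count≥3 ys
count≥3-++≤ []       ys = ≤-refl
count≥3-++≤ (x ∷ xs) ys = ≤-trans (count≥3-∷≤ x (xs ++ ys)) (s≤s (count≥3-++≤ xs ys))

count≥3-++≥ : ∀ xs ys → All (3 ≤_) xs → length xs ≤ count≥3 (xs ++ ys)
count≥3-++≥ []       ys []           = z≤n
count≥3-++≥ (x ∷ xs) ys (3≤x ∷ 3≤xs) =
  ≤-trans (s≤s (count≥3-++≥ xs ys 3≤xs)) (≤-reflexive (sym (count≥3-accept (xs ++ ys) 3≤x)))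

sum≥2*length+count≥3 : ∀ xs → All (2 ≤_) xs → 2 * length xs + count≥3 xs ≤ sum xs
sum≥2*length+count≥3 []       []           = z≤n
sum≥2*length+count≥3 (x ∷ xs) (2≤x ∷ 2≤xs) with 3 ≤? x
... | yes 3≤x = begin
  2 * suc (length xs) + count≥3 (x ∷ xs) ≡⟨ cong (2 * suc (length xs) +_) (count≥3-accept xs 3≤x) ⟩
  2 * suc (length xs) + suc (count≥3 xs) ≡⟨ shift (length xs) (count≥3 xs) ⟩
  3 + (2 * length xs + count≥3 xs)       ≤⟨ +-mono-≤ 3≤x (sum≥2*length+count≥3 xs 2≤xs) ⟩
  x + sum xs                             ∎
  where
  open ≤-Reasoning
  shift : ∀ l c → 2 * suc l + suc c ≡ 3 + (2 * l + c)
  shift = solve-∀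
... | no  3≰x = begin
  2 * suc (length xs) + count≥3 (x ∷ xs) ≡⟨ cong (2 * suc (length xs) +_) (count≥3-reject xs 3≰x) ⟩
  2 * suc (length xs) + count≥3 xs       ≡⟨ shift (length xs) (count≥3 xs) ⟩
  2 + (2 * length xs + count≥3 xs)       ≤⟨ +-mono-≤ 2≤x (sum≥2*length+count≥3 xs 2≤xs) ⟩
  x + sum xs                             ∎
  where
  open ≤-Reasoning
  shift : ∀ l c → 2 * suc l + c ≡ 2 + (2 * l + c)
  shift = solve-∀

2∣m+m : ∀ m → 2 ∣ m + m
2∣m+m m = divides m (double m)
  where
  double : ∀ m → m + m ≡ m * 2
  double = solve-∀

even-≤-pred : ∀ {x y} → 2 ∣ x → 2 ∣ y → x ≤ suc y → x ≤ y
even-≤-pred (divides-refl p) (divides-refl q) = halves p q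
  where
  halves : ∀ p q → p * 2 ≤ suc (q * 2) → p * 2 ≤ q * 2
  halves zero    q       _               = z≤n
  halves (suc p) zero    (s≤s ())
  halves (suc p) (suc q) (s≤s (s≤s le)) = s≤s (s≤s (halves p q le))

sum+6≡4n⇒even : ∀ {t n} → t + 6 ≡ 4 * n → 2 ∣ t
sum+6≡4n⇒even {t} {n} eq =
  ∣m+n∣m⇒∣n (subst (2 ∣_) (trans (sym eq) (+-comm t 6)) (∣m⇒∣m*n n (divides 2 refl))) (divides 3 refl)

-- Sparse sequences

record Sparse (s n : ℕ) (xs : List ℕ) : Set where
  constructor sparse
  field
    length≡ : length xs ≡ n
    all≥2   : All (2 ≤_) xs
    all<    : All (_< n) xs
    sum≤    : sum xs + s ≤ 4 * n
    even    : 2 ∣ sum xs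

Sparse-↭ : ∀ {s n xs ys} → xs ↭ ys → Sparse s n xs → Sparse s n ys
Sparse-↭ {s} {n} xs↭ys (sparse len 2≤xs xs<n bound even) = sparse
  (trans (sym (↭-length xs↭ys)) len)
  (All-resp-↭ xs↭ys 2≤xs)
  (All-resp-↭ xs↭ys xs<n)
  (subst (λ t → t + s ≤ 4 * n) (sum-↭ xs↭ys) bound)
  (subst (2 ∣_) (sum-↭ xs↭ys) even)

sparse-min<4 : ∀ {s n k zs} → All (k ≤_) zs → Sparse (suc s) n (k ∷ zs) → k < 4
sparse-min<4 {s} {k = k} {zs} k≤zs (sparse refl _ _ bound _) = ≰⇒> λ 4≤k → <-irrefl refl (begin-strict
  4 * length (k ∷ zs)  ≤⟨ sum-≥ (k ∷ zs) (4≤k ∷ All.map (≤-trans 4≤k) k≤zs) ⟩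
  sum (k ∷ zs)         <⟨ m<m+n (sum (k ∷ zs)) (s≤s z≤n) ⟩
  sum (k ∷ zs) + suc s ≤⟨ bound ⟩
  4 * length (k ∷ zs)  ∎)
  where open ≤-Reasoning

sum-incrementPrefix : ∀ k xs → k ≤ length xs → sum (incrementPrefix k xs) ≡ k + sum xs
sum-incrementPrefix zero    xs       _         = refl
sum-incrementPrefix (suc k) (x ∷ xs) (s≤s k≤n) =
  trans (cong (suc x +_) (sum-incrementPrefix k xs k≤n)) (swap-summands x k (sum xs))
  where
  swap-summands : ∀ x k t → suc x + (k + t) ≡ suc k + (x + t)
  swap-summands = solve-∀

sum-layOff : ∀ k R → k ≤ length R → sum (k ∷ incrementPrefix k R) ≡ (k + k) + sum R
sum-layOff k R k≤n = trans (cong (k +_) (sum-incrementPrefix k R k≤n)) (sym (+-assoc k k (sum R)))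

residual-sum≤ : ∀ {s s′} k R → k ≤ length R →
  sum (k ∷ incrementPrefix k R) + s ≤ 4 * suc (length R) → s′ + 4 ≤ s + (k + k) → sum R + s′ ≤ 4 * length R
residual-sum≤ {s} {s′} k R k≤n bound slack = +-cancelˡ-≤ 4 _ _ (begin
  4 + (sum R + s′)                  ≡⟨ +-comm 4 (sum R + s′) ⟩
  sum R + s′ + 4                    ≡⟨ +-assoc (sum R) s′ 4 ⟩
  sum R + (s′ + 4)                  ≤⟨ +-monoʳ-≤ (sum R) slack ⟩
  sum R + (s + (k + k))             ≡⟨ rearrange (sum R) s (k + k) ⟩
  (k + k) + sum R + s               ≡⟨ cong (_+ s) (sum-layOff k R k≤n) ⟨
  sum (k ∷ incrementPrefix k R) + s ≤⟨ bound ⟩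
  4 * suc (length R)                ≡⟨ *-suc 4 (length R) ⟩
  4 + 4 * length R                  ∎)
  where
  open ≤-Reasoning
  rearrange : ∀ a b c → a + (b + c) ≡ c + a + b
  rearrange = solve-∀

residual-even : ∀ k R → k ≤ length R → 2 ∣ sum (k ∷ incrementPrefix k R) → 2 ∣ sum R
residual-even k R k≤n even = ∣m+n∣m⇒∣n (subst (2 ∣_) (sum-layOff k R k≤n) even) (2∣m+m k)

untouched<-two₆ : ∀ {a b} rest → Descending (a ∷ b ∷ rest) → All (2 ≤_) rest →
  sum (2 ∷ a ∷ b ∷ rest) + 6 ≤ 4 * (3 + length rest) → All (_< 2 + length rest) rest
untouched<-two₆ []         _ _ _ = []
untouched<-two₆ {a} {b} (c ∷ rest) (b≤a ∷ c≤b ∷ c∷rest↘) (_ ∷ 2≤rest) bound =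
  descending-all< c∷rest↘ (≰⇒> crowded)
  where
  r : ℕ
  r = length rest
  crowded : 3 + r ≤ c → ⊥
  crowded m≤c = <-irrefl refl (begin-strict
    4 * (4 + r)                                        <⟨ m<m+n (4 * (4 + r)) (s≤s z≤n) ⟩
    4 * (4 + r) + suc r                                ≡⟨ expand r ⟩
    2 + ((3 + r) + ((3 + r) + ((3 + r) + 2 * r))) + 6 ≤⟨ +-monoˡ-≤ 6 (+-monoʳ-≤ 2
                                                            (+-mono-≤ (≤-trans m≤b b≤a) (+-mono-≤ m≤b
                                                            (+-mono-≤ m≤c (sum-≥ rest 2≤rest))))) ⟩
    sum (2 ∷ a ∷ b ∷ c ∷ rest) + 6                     ≤⟨ bound ⟩
    4 * (4 + r)                                        ∎)
    where
    open ≤-Reasoning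
    m≤b : 3 + r ≤ b
    m≤b = ≤-trans m≤c c≤b
    expand : ∀ r → 4 * (4 + r) + suc r ≡ 2 + ((3 + r) + ((3 + r) + ((3 + r) + 2 * r))) + 6
    expand = solve-∀

untouched<-two₄ : ∀ {a b} rest → Descending (a ∷ b ∷ rest) → All (2 ≤_) rest → 4 ≤ count≥3 (a ∷ b ∷ rest) →
  sum (2 ∷ a ∷ b ∷ rest) + 4 ≤ 4 * (3 + length rest) → All (_< 2 + length rest) rest
untouched<-two₄ []         _ _ _ _ = []
untouched<-two₄ {a} {b} (c ∷ rest) (b≤a ∷ c≤b ∷ c∷rest↘) (_ ∷ 2≤rest) big bound =
  descending-all< c∷rest↘ (≰⇒> crowded)
  where
  r : ℕ
  r = length rest
  1≤count : 1 ≤ count≥3 rest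
  1≤count = +-cancelˡ-≤ 3 _ _ (≤-trans big (count≥3-++≤ (a ∷ b ∷ c ∷ []) rest))
  crowded : 3 + r ≤ c → ⊥
  crowded m≤c = <-irrefl refl (begin-strict
    4 * (4 + r)                                              <⟨ m<m+n (4 * (4 + r)) (≤-trans 1≤count (count≥3≤length rest)) ⟩
    4 * (4 + r) + r                                          ≡⟨ expand r ⟩
    2 + ((3 + r) + ((3 + r) + ((3 + r) + (2 * r + 1)))) + 4 ≤⟨ +-monoˡ-≤ 4 (+-monoʳ-≤ 2
                                                                  (+-mono-≤ (≤-trans m≤b b≤a) (+-mono-≤ m≤b
                                                                  (+-mono-≤ m≤c sum-rest≥)))) ⟩
    sum (2 ∷ a ∷ b ∷ c ∷ rest) + 4                           ≤⟨ bound ⟩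
    4 * (4 + r)                                              ∎)
    where
    open ≤-Reasoning
    m≤b : 3 + r ≤ b
    m≤b = ≤-trans m≤c c≤b
    sum-rest≥ : 2 * r + 1 ≤ sum rest
    sum-rest≥ = ≤-trans (+-monoʳ-≤ (2 * r) 1≤count) (sum≥2*length+count≥3 rest 2≤rest)
    expand : ∀ r → 4 * (4 + r) + r ≡ 2 + ((3 + r) + ((3 + r) + ((3 + r) + (2 * r + 1)))) + 4
    expand = solve-∀

untouched<-three : ∀ {a b c} rest → Descending (a ∷ b ∷ c ∷ rest) → All (2 ≤_) rest →
  sum (3 ∷ a ∷ b ∷ c ∷ rest) + 4 ≤ 4 * (4 + length rest) → All (_< 3 + length rest) rest
untouched<-three []         _ _ _ = []
untouched<-three {a} {b} {c} (d ∷ rest) (b≤a ∷ c≤b ∷ d≤c ∷ d∷rest↘) (_ ∷ 2≤rest) bound =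
  descending-all< d∷rest↘ (≰⇒> crowded)
  where
  r : ℕ
  r = length rest
  crowded : 4 + r ≤ d → ⊥
  crowded m≤d = <-irrefl refl (begin-strict
    4 * (5 + r)                                                    <⟨ m<m+n (4 * (5 + r)) (s≤s z≤n) ⟩
    4 * (5 + r) + suc (2 + 2 * r)                                  ≡⟨ expand r ⟩
    3 + ((4 + r) + ((4 + r) + ((4 + r) + ((4 + r) + 2 * r)))) + 4 ≤⟨ +-monoˡ-≤ 4 (+-monoʳ-≤ 3
                                                                        (+-mono-≤ (≤-trans m≤b b≤a) (+-mono-≤ m≤b
                                                                        (+-mono-≤ m≤c (+-mono-≤ m≤d (sum-≥ rest 2≤rest)))))) ⟩
    sum (3 ∷ a ∷ b ∷ c ∷ d ∷ rest) + 4                             ≤⟨ bound ⟩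
    4 * (5 + r)                                                    ∎)
    where
    open ≤-Reasoning
    m≤c : 4 + r ≤ c
    m≤c = ≤-trans m≤d d≤c
    m≤b : 4 + r ≤ b
    m≤b = ≤-trans m≤c c≤b
    expand : ∀ r → 4 * (5 + r) + suc (2 + 2 * r) ≡ 3 + ((4 + r) + ((4 + r) + ((4 + r) + ((4 + r) + 2 * r)))) + 4
    expand = solve-∀

untouched<-one : ∀ {a} rest → Descending (a ∷ rest) → All (2 ≤_) rest → 4 ≤ count≥3 (a ∷ rest) →
  sum (1 ∷ a ∷ rest) + 6 ≤ 4 * (2 + length rest) → All (_< 1 + length rest) rest
untouched<-one []         _ _ _ _ = []
untouched<-one {a} (b ∷ rest) (b≤a ∷ b∷rest↘) (_ ∷ 2≤rest) big bound =
  descending-all< b∷rest↘ (≰⇒> crowded)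
  where
  r : ℕ
  r = length rest
  2≤count : 2 ≤ count≥3 rest
  2≤count = +-cancelˡ-≤ 2 _ _ (≤-trans big (count≥3-++≤ (a ∷ b ∷ []) rest))
  crowded : 2 + r ≤ b → ⊥
  crowded m≤b = <-irrefl refl (begin-strict
    4 * (3 + r)                                   <⟨ m<m+n (4 * (3 + r)) (s≤s z≤n) ⟩
    4 * (3 + r) + 1                               ≡⟨ expand r ⟩
    1 + ((2 + r) + ((2 + r) + (2 * r + 2))) + 6  ≤⟨ +-monoˡ-≤ 6 (+-monoʳ-≤ 1
                                                       (+-mono-≤ (≤-trans m≤b b≤a) (+-mono-≤ m≤b sum-rest≥))) ⟩
    sum (1 ∷ a ∷ b ∷ rest) + 6                    ≤⟨ bound ⟩
    4 * (3 + r)                                   ∎)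
    where
    open ≤-Reasoning
    sum-rest≥ : 2 * r + 2 ≤ sum rest
    sum-rest≥ = ≤-trans (+-monoʳ-≤ (2 * r) 2≤count) (sum≥2*length+count≥3 rest 2≤rest)
    expand : ∀ r → 4 * (3 + r) + 1 ≡ 1 + ((2 + r) + ((2 + r) + (2 * r + 2))) + 6
    expand = solve-∀

layOffThree : ∀ {s m a b c rest} → (∀ {R} → Sparse 6 m R → GraphicalList R) → 4 ≤ s →
  Sparse s (suc m) (3 ∷ a ∷ b ∷ c ∷ rest) → All (3 ≤_) (a ∷ b ∷ c ∷ rest) → Descending (a ∷ b ∷ c ∷ rest) →
  GraphicalList (3 ∷ a ∷ b ∷ c ∷ rest)
layOffThree {a = suc a} {suc b} {suc c} {rest} graphical₆ 4≤s
  (sparse refl (_ ∷ _ ∷ _ ∷ _ ∷ 2≤rest) (_ ∷ a< ∷ b< ∷ c< ∷ _) bound even)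
  (s≤s 2≤a ∷ s≤s 2≤b ∷ s≤s 2≤c ∷ _) abc↘ =
  graphical-layOff 3 R 3≤ (graphical₆ (sparse refl
    (2≤a ∷ 2≤b ∷ 2≤c ∷ 2≤rest)
    (≤-pred a< ∷ ≤-pred b< ∷ ≤-pred c< ∷ untouched<-three rest abc↘ 2≤rest (≤-trans (+-monoʳ-≤ _ 4≤s) bound))
    (residual-sum≤ 3 R 3≤ bound (+-monoˡ-≤ 6 4≤s))
    (residual-even 3 R 3≤ even)))
  where
  R : List ℕ
  R = a ∷ b ∷ c ∷ rest
  3≤ : 3 ≤ length R
  3≤ = s≤s (s≤s (s≤s z≤n))

layOffTwo₆ : ∀ {m a b rest} → (∀ {R} → Sparse 6 m R → GraphicalList R) →
  Sparse 6 (suc m) (2 ∷ a ∷ b ∷ rest) → Descending (a ∷ b ∷ rest) → GraphicalList (2 ∷ a ∷ b ∷ rest)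
layOffTwo₆ {a = a} {b = 2} {rest} _
  (sparse refl (_ ∷ 2≤a ∷ _ ∷ 2≤rest) (_ ∷ a< ∷ _) _ even) (_ ∷ 2∷rest↘) =
  graphical-↭ (swap a 2 ↭-refl)
    (subst (λ xs → GraphicalList (a ∷ 2 ∷ 2 ∷ xs)) (sym rest≡twos)
      (graphical-even∷twos a-even 2≤a (≤-pred a<)))
  where
  rest≡twos : rest ≡ replicate (length rest) 2
  rest≡twos = ≡replicate rest 2≤rest (descending-head 2∷rest↘)
  a-even : 2 ∣ a
  a-even = ∣m+n∣m⇒∣n (subst (2 ∣_) (rearrange a (sum rest)) even)
    (∣m∣n⇒∣m+n (divides 2 refl) (divides (length rest) (trans (cong sum rest≡twos) (sum-replicate (length rest) 2))))
    where
    rearrange : ∀ a t → 2 + (a + (2 + t)) ≡ (4 + t) + a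
    rearrange = solve-∀
layOffTwo₆ {b = 1} _ (sparse _ (_ ∷ _ ∷ s≤s () ∷ _) _ _ _) _
layOffTwo₆ {a = suc a} {b = suc (suc (suc b))} {rest} graphical₆
  (sparse refl (_ ∷ _ ∷ _ ∷ 2≤rest) (_ ∷ a< ∷ b< ∷ _) bound even) ab↘@(s≤s b≤a ∷ _) =
  graphical-layOff 2 R 2≤ (graphical₆ (sparse refl
    (≤-trans 2≤b b≤a ∷ 2≤b ∷ 2≤rest)
    (≤-pred a< ∷ ≤-pred b< ∷ untouched<-two₆ rest ab↘ 2≤rest bound)
    (residual-sum≤ 2 R 2≤ bound ≤-refl)
    (residual-even 2 R 2≤ even)))
  where
  R : List ℕ
  R = a ∷ suc (suc b) ∷ rest
  2≤ : 2 ≤ length R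
  2≤ = s≤s (s≤s z≤n)
  2≤b : 2 ≤ suc (suc b)
  2≤b = s≤s (s≤s z≤n)

layOffMin₆ : ∀ {m k zs} → (∀ {R} → Sparse 6 m R → GraphicalList R) →
  Sparse 6 (suc m) (k ∷ zs) → All (k ≤_) zs → Descending zs → GraphicalList (k ∷ zs)
layOffMin₆ {k = 0} _ (sparse _ (() ∷ _) _ _ _) _ _
layOffMin₆ {k = 1} _ (sparse _ (s≤s () ∷ _) _ _ _) _ _
layOffMin₆ {k = 2} {[]}          _ (sparse refl _ (s≤s () ∷ _) _ _) _ _
layOffMin₆ {k = 2} {_ ∷ []}      _ (sparse refl _ (s≤s (s≤s ()) ∷ _) _ _) _ _
layOffMin₆ {k = 2} {_ ∷ _ ∷ _}   graphical₆ S _ zs↘ = layOffTwo₆ graphical₆ S zs↘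
layOffMin₆ {k = 3} {[]}          _ (sparse refl _ (s≤s () ∷ _) _ _) _ _
layOffMin₆ {k = 3} {_ ∷ []}      _ (sparse refl _ (s≤s (s≤s ()) ∷ _) _ _) _ _
layOffMin₆ {k = 3} {_ ∷ _ ∷ []}  _ (sparse refl _ (s≤s (s≤s (s≤s ())) ∷ _) _ _) _ _
layOffMin₆ {k = 3} {_ ∷ _ ∷ _ ∷ _} graphical₆ S k≤zs zs↘ =
  layOffThree graphical₆ (s≤s (s≤s (s≤s (s≤s z≤n)))) S k≤zs zs↘
layOffMin₆ {k = suc (suc (suc (suc _)))} _ S k≤zs _ with sparse-min<4 k≤zs S
... | s≤s (s≤s (s≤s (s≤s ())))

graphical-sparse₆ : ∀ n {xs} → Sparse 6 n xs → GraphicalList xs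
graphical-sparse₆ _       {[]}     _                   = graphical-[]
graphical-sparse₆ zero    {_ ∷ _}  (sparse () _ _ _ _)
graphical-sparse₆ (suc m) {x ∷ xs} S with splitMin x xs
... | minFirst xs↭ k≤zs zs↘ =
  graphical-↭ (↭-sym xs↭) (layOffMin₆ (graphical-sparse₆ m) (Sparse-↭ xs↭ S) k≤zs zs↘)

layOffTwo₄⇒sparse₆ : ∀ {m a rest} → Sparse 4 (suc m) (2 ∷ suc a ∷ 3 ∷ rest) → 4 ≤ count≥3 (suc a ∷ 3 ∷ rest) →
  2 ≤ a → Descending (3 ∷ rest) → GraphicalList (2 ∷ suc a ∷ 3 ∷ rest)
layOffTwo₄⇒sparse₆ {a = a} {rest}
  (sparse refl (_ ∷ _ ∷ _ ∷ 2≤rest) (_ ∷ a< ∷ _) _ even) big 2≤a 3∷rest↘ =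
  graphical-layOff 2 R (s≤s (s≤s z≤n)) (graphical-sparse₆ _ (sparse refl
    (2≤a ∷ ≤-refl ∷ 2≤rest)
    (≤-pred a< ∷ +-monoʳ-≤ 2 (≤-trans (s≤s z≤n) 2≤r) ∷ All.map (λ x≤3 → ≤-<-trans x≤3 (+-monoʳ-≤ 2 2≤r)) (descending-head 3∷rest↘))
    sum≤
    even′))
  where
  R : List ℕ
  R = a ∷ 2 ∷ rest
  r : ℕ
  r = length rest
  even′ : 2 ∣ sum R
  even′ = residual-even 2 R (s≤s (s≤s z≤n)) even
  2≤r : 2 ≤ r
  2≤r = +-cancelˡ-≤ 2 _ _ (≤-trans big (≤-trans (count≥3-++≤ (suc a ∷ 3 ∷ []) rest) (+-monoʳ-≤ 2 (count≥3≤length rest))))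
  sum≤ : sum R + 6 ≤ 4 * (2 + r)
  sum≤ = even-≤-pred (∣m∣n⇒∣m+n even′ (divides 3 refl)) (∣m⇒∣m*n (2 + r) (divides 2 refl)) (begin
    a + (2 + sum rest) + 6   ≤⟨ +-monoˡ-≤ 6 (+-mono-≤ (≤-pred (≤-pred a<)) (+-monoʳ-≤ 2 (sum-≤ rest (descending-head 3∷rest↘)))) ⟩
    suc r + (2 + 3 * r) + 6  ≡⟨ expand r ⟩
    suc (4 * (2 + r))        ∎)
    where
    open ≤-Reasoning
    expand : ∀ r → suc r + (2 + 3 * r) + 6 ≡ suc (4 * (2 + r))
    expand = solve-∀

layOffTwo₄ : ∀ {m a b rest} → (∀ {R} → Sparse 4 m R → 4 ≤ count≥3 R → GraphicalList R) →
  Sparse 4 (suc m) (2 ∷ a ∷ b ∷ rest) → 4 ≤ count≥3 (a ∷ b ∷ rest) → Descending (a ∷ b ∷ rest) →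
  GraphicalList (2 ∷ a ∷ b ∷ rest)
layOffTwo₄ {b = 0} _ (sparse _ (_ ∷ _ ∷ () ∷ _) _ _ _) _ _
layOffTwo₄ {b = 1} _ (sparse _ (_ ∷ _ ∷ s≤s () ∷ _) _ _ _) _ _
layOffTwo₄ {a = a} {b = 2} {rest} _ _ big (_ ∷ 2∷rest↘) = ⊥-elim (<⇒≱ (s≤s (s≤s z≤n)) (≤-trans big few))
  where
  few : count≥3 (a ∷ 2 ∷ rest) ≤ 1
  few = ≤-trans (count≥3-++≤ (a ∷ []) (2 ∷ rest)) (≤-reflexive (cong suc (count≥3-≤2 rest (descending-head 2∷rest↘))))
layOffTwo₄ {a = suc a} {b = 3} _ S big (s≤s 2≤a ∷ 3∷rest↘) = layOffTwo₄⇒sparse₆ S big 2≤a 3∷rest↘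
-- The lowered entries stay ≥ 3, so count≥3 R computes to the same value as before and big is reused.
layOffTwo₄ {a = suc (suc (suc (suc a)))} {b = suc (suc (suc (suc b)))} {rest} graphical₄
  (sparse refl (_ ∷ _ ∷ _ ∷ 2≤rest) (_ ∷ a< ∷ b< ∷ _) bound even) big ab↘@(s≤s (s≤s (s≤s (s≤s _))) ∷ _) =
  graphical-layOff 2 R 2≤ (graphical₄ (sparse refl
    (s≤s (s≤s z≤n) ∷ s≤s (s≤s z≤n) ∷ 2≤rest)
    (≤-pred a< ∷ ≤-pred b< ∷ untouched<-two₄ rest ab↘ 2≤rest big bound)
    (residual-sum≤ 2 R 2≤ bound ≤-refl)
    (residual-even 2 R 2≤ even)) big)
  where
  R : List ℕ
  R = suc (suc (suc a)) ∷ suc (suc (suc b)) ∷ rest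
  2≤ : 2 ≤ length R
  2≤ = s≤s (s≤s z≤n)

layOffMin₄ : ∀ {m k zs} → (∀ {R} → Sparse 4 m R → 4 ≤ count≥3 R → GraphicalList R) →
  Sparse 4 (suc m) (k ∷ zs) → 4 ≤ count≥3 (k ∷ zs) → All (k ≤_) zs → Descending zs → GraphicalList (k ∷ zs)
layOffMin₄ {k = 0} _ (sparse _ (() ∷ _) _ _ _) _ _ _
layOffMin₄ {k = 1} _ (sparse _ (s≤s () ∷ _) _ _ _) _ _ _
layOffMin₄ {k = 2} {[]}          _ (sparse refl _ (s≤s () ∷ _) _ _) _ _ _
layOffMin₄ {k = 2} {_ ∷ []}      _ (sparse refl _ (s≤s (s≤s ()) ∷ _) _ _) _ _ _
layOffMin₄ {k = 2} {_ ∷ _ ∷ _}   graphical₄ S big _ zs↘ = layOffTwo₄ graphical₄ S big zs↘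
layOffMin₄ {k = 3} {[]}          _ (sparse refl _ (s≤s () ∷ _) _ _) _ _ _
layOffMin₄ {k = 3} {_ ∷ []}      _ (sparse refl _ (s≤s (s≤s ()) ∷ _) _ _) _ _ _
layOffMin₄ {k = 3} {_ ∷ _ ∷ []}  _ (sparse refl _ (s≤s (s≤s (s≤s ())) ∷ _) _ _) _ _ _
layOffMin₄ {k = 3} {_ ∷ _ ∷ _ ∷ _} _ S _ k≤zs zs↘ = layOffThree (graphical-sparse₆ _) ≤-refl S k≤zs zs↘
layOffMin₄ {k = suc (suc (suc (suc _)))} _ S _ k≤zs _ with sparse-min<4 k≤zs S
... | s≤s (s≤s (s≤s (s≤s ())))

graphical-sparse₄ : ∀ n {xs} → Sparse 4 n xs → 4 ≤ count≥3 xs → GraphicalList xs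
graphical-sparse₄ _       {[]}     _                   _ = graphical-[]
graphical-sparse₄ zero    {_ ∷ _}  (sparse () _ _ _ _) _
graphical-sparse₄ (suc m) {x ∷ xs} S big with splitMin x xs
... | minFirst xs↭ k≤zs zs↘ = graphical-↭ (↭-sym xs↭)
  (layOffMin₄ (graphical-sparse₄ m) (Sparse-↭ xs↭ S) (subst (4 ≤_) (count≥3-↭ xs↭) big) k≤zs zs↘)

layOffPendant⇒sparse₆ : ∀ {rest} → Descending (3 ∷ rest) → All (2 ≤_) rest →
  2 ∣ sum (1 ∷ 3 ∷ rest) → 4 ≤ count≥3 (3 ∷ rest) → GraphicalList (1 ∷ 3 ∷ rest)
layOffPendant⇒sparse₆ {rest} 3∷rest↘ 2≤rest even (s≤s 3≤count) =
  graphical-layOff 1 R (s≤s z≤n) (graphical-sparse₆ _ (sparse refl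
    (≤-refl ∷ 2≤rest)
    (s≤s (≤-trans (s≤s (s≤s z≤n)) 3≤r) ∷ All.map (λ x≤3 → s≤s (≤-trans x≤3 3≤r)) (descending-head 3∷rest↘))
    sum≤
    even′))
  where
  R : List ℕ
  R = 2 ∷ rest
  r : ℕ
  r = length rest
  even′ : 2 ∣ sum R
  even′ = residual-even 1 R (s≤s z≤n) even
  3≤r : 3 ≤ r
  3≤r = ≤-trans 3≤count (count≥3≤length rest)
  sum≤ : sum R + 6 ≤ 4 * suc r
  sum≤ = even-≤-pred (∣m∣n⇒∣m+n even′ (divides 3 refl)) (∣m⇒∣m*n (suc r) (divides 2 refl)) (begin
    2 + sum rest + 6     ≤⟨ +-monoˡ-≤ 6 (+-monoʳ-≤ 2 (sum-≤ rest (descending-head 3∷rest↘))) ⟩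
    2 + 3 * r + 6        ≡⟨ expand r ⟩
    5 + (3 + 3 * r)      ≤⟨ +-monoʳ-≤ 5 (+-monoˡ-≤ (3 * r) 3≤r) ⟩
    5 + (r + 3 * r)      ≡⟨ collect r ⟩
    suc (4 * suc r)      ∎)
    where
    open ≤-Reasoning
    expand : ∀ r → 2 + 3 * r + 6 ≡ 5 + (3 + 3 * r)
    expand = solve-∀
    collect : ∀ r → 5 + (r + 3 * r) ≡ suc (4 * suc r)
    collect = solve-∀

layOffPendant : ∀ {m zs} → Descending zs → length zs ≡ m → All (2 ≤_) zs → All (_< suc m) zs →
  sum (1 ∷ zs) + 6 ≤ 4 * suc m → 2 ∣ sum (1 ∷ zs) → 4 ≤ count≥3 zs → GraphicalList (1 ∷ zs)
layOffPendant {zs = []} _ _ _ _ _ _ ()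
layOffPendant {zs = 0 ∷ _} _ _ (() ∷ _) _ _ _ _
layOffPendant {zs = 1 ∷ _} _ _ (s≤s () ∷ _) _ _ _ _
layOffPendant {zs = 2 ∷ rest} 2∷rest↘ _ _ _ _ _ big
  with () ← subst (4 ≤_) (count≥3-≤2 rest (descending-head 2∷rest↘)) big
layOffPendant {zs = 3 ∷ _} 3∷rest↘ _ (_ ∷ 2≤rest) _ _ even big = layOffPendant⇒sparse₆ 3∷rest↘ 2≤rest even big
layOffPendant {zs = suc (suc (suc (suc a))) ∷ rest} a∷rest↘ refl (_ ∷ 2≤rest) (a< ∷ _) bound even big =
  graphical-layOff 1 R (s≤s z≤n) (graphical-sparse₄ _ (sparse refl
    (s≤s (s≤s z≤n) ∷ 2≤rest)
    (≤-pred a< ∷ untouched<-one rest a∷rest↘ 2≤rest big bound)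
    (residual-sum≤ 1 R (s≤s z≤n) bound ≤-refl)
    (residual-even 1 R (s≤s z≤n) even)) big)
  where
  R : List ℕ
  R = suc (suc (suc a)) ∷ rest

graphical-pendant : ∀ {m} ys → length ys ≡ m → All (2 ≤_) ys → All (_< suc m) ys →
  sum (1 ∷ ys) + 6 ≤ 4 * suc m → 2 ∣ sum (1 ∷ ys) → 4 ≤ count≥3 ys → GraphicalList (1 ∷ ys)
graphical-pendant {m} ys len 2≤ys ys< bound even big with descending-↭ ys
... | zs , ys↭zs , zs↘ = graphical-↭ (prep 1 (↭-sym ys↭zs)) (layOffPendant zs↘
  (trans (sym (↭-length ys↭zs)) len)
  (All-resp-↭ ys↭zs 2≤ys)
  (All-resp-↭ ys↭zs ys<)
  (subst (λ t → 1 + t + 6 ≤ 4 * suc m) (sum-↭ ys↭zs) bound)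
  (subst (λ t → 2 ∣ 1 + t) (sum-↭ ys↭zs) even)
  (subst (4 ≤_) (count≥3-↭ ys↭zs) big))

-- The sequences of the statement

graphical-sum≡4n-6 : ∀ {m} x ys → length ys ≡ m → All (_< suc m) (x ∷ ys) → 1 ≤ x → All (2 ≤_) ys →
  4 ≤ count≥3 ys → x + sum ys + 6 ≡ 4 * suc m → GraphicalList (x ∷ ys)
graphical-sum≡4n-6 {m} 1 ys len (_ ∷ ys<) _ 2≤ys big eq =
  graphical-pendant ys len 2≤ys ys< (≤-reflexive eq) (sum+6≡4n⇒even {n = suc m} eq) big
graphical-sum≡4n-6 {m} (suc (suc x)) ys refl xys< _ 2≤ys _ eq =
  graphical-sparse₆ _ (sparse refl (s≤s (s≤s z≤n) ∷ 2≤ys) xys< (≤-reflexive eq) (sum+6≡4n⇒even {n = suc m} eq))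

at-fromℕ< : ∀ {n} (d : Seq n) {k} (k<n : k < n) → d at suc k ≡ d (fromℕ< k<n)
at-fromℕ< {n} d {k} k<n with k <? n
... | yes _   = refl
... | no  k≮n = ⊥-elim (k≮n k<n)

total≡sum-tabulate : ∀ {n} (d : Seq n) → total d ≡ sum (tabulate d)
total≡sum-tabulate d = cong sum (map-tabulate id d)

tabulate↭last∷ : ∀ {m} (d : Seq (suc m)) → tabulate d ↭ d (fromℕ< ≤-refl) ∷ tabulate (d ∘ inject₁)
tabulate↭last∷ {zero}  d = ↭-refl
tabulate↭last∷ {suc m} d = ↭-trans (prep (d zero) (tabulate↭last∷ (d ∘ suc))) (swap _ _ ↭-refl)

4[n-1]-2+6≡4n : ∀ m → 4 * (4 + m) ∸ 2 + 6 ≡ 4 * (5 + m)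
4[n-1]-2+6≡4n m = begin
  4 * (4 + m) ∸ 2 + 6         ≡⟨ cong (λ t → t ∸ 2 + 6) (split m) ⟩
  2 + (14 + 4 * m) ∸ 2 + 6    ≡⟨ collect m ⟩
  4 * (5 + m)                 ∎
  where
  open ≡-Reasoning
  split : ∀ m → 4 * (4 + m) ≡ 2 + (14 + 4 * m)
  split = solve-∀
  collect : ∀ m → 14 + 4 * m + 6 ≡ 4 * (5 + m)
  collect = solve-∀

graphical-nonIncreasing : ∀ m (d : Seq (5 + m)) → NonIncreasing d → sum (tabulate d) + 6 ≡ 4 * (5 + m) →
  d zero ≤ 4 + m → 2 ≤ d (fromℕ< (n≤1+n (4 + m))) → 1 ≤ d (fromℕ< ≤-refl) → 3 ≤ d (suc (suc (suc zero))) →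
  Graphical d
graphical-nonIncreasing m d d↘ sum≡4n d₁≤ 2≤dₙ₋₁ 1≤dₙ 3≤d₄ =
  graphical-tabulate d (graphical-↭ (↭-sym last∷init)
    (graphical-sum≡4n-6 (d last) init (length-tabulate (d ∘ inject₁)) (All-resp-↭ last∷init (tabulate⁺ d<n))
      1≤dₙ (tabulate⁺ init≥2) four≥3 (trans (cong (_+ 6) (sym (sum-↭ last∷init))) sum≡4n)))
  where
  last : Fin (5 + m)
  last = fromℕ< ≤-refl
  init : List ℕ
  init = tabulate (d ∘ inject₁)
  last∷init : tabulate d ↭ d last ∷ init
  last∷init = tabulate↭last∷ d
  d<n : ∀ i → d i < 5 + m
  d<n i = s≤s (≤-trans (d↘ zero i z≤n) d₁≤)
  init≥2 : ∀ i → 2 ≤ d (inject₁ i)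
  init≥2 i = ≤-trans 2≤dₙ₋₁
    (d↘ (inject₁ i) _ (subst₂ _≤_ (sym (toℕ-inject₁ i)) (sym (toℕ-fromℕ< (n≤1+n (4 + m)))) (toℕ≤pred[n] i)))
  ≥d₄ : ∀ i → toℕ i ≤ 3 → 3 ≤ d i
  ≥d₄ i i≤3 = ≤-trans 3≤d₄ (d↘ i _ i≤3)
  four≥3 : 4 ≤ count≥3 init
  four≥3 = count≥3-++≥ (d zero ∷ d (suc zero) ∷ d (suc (suc zero)) ∷ d (suc (suc (suc zero))) ∷ [])
    (tabulate (λ i → d (inject₁ (suc (suc (suc (suc i)))))))
    (≥d₄ zero z≤n ∷ ≥d₄ (suc zero) (s≤s z≤n) ∷ ≥d₄ (suc (suc zero)) (s≤s (s≤s z≤n)) ∷ ≥d₄ (suc (suc (suc zero))) ≤-refl ∷ [])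

corollary2p3 : (n : ℕ) (d : Seq n) → NonIncreasing d
    → total d ≡ 4 * (n ∸ 1) ∸ 2
    → 4 < n
    → d at 1 ≤ n ∸ 1
    → 2 ≤ d at (n ∸ 1)
    → 1 ≤ d at n
    → 3 ≤ d at 4
    → Graphical d
corollary2p3 .(5 + m) d d↘ total≡ (s≤s (s≤s (s≤s (s≤s (s≤s (z≤n {m})))))) d₁≤ 2≤dₙ₋₁ 1≤dₙ 3≤d₄ =
  graphical-nonIncreasing m d d↘ sum≡4n d₁≤
    (subst (2 ≤_) (at-fromℕ< d (n≤1+n (4 + m))) 2≤dₙ₋₁)
    (subst (1 ≤_) (at-fromℕ< d ≤-refl) 1≤dₙ)
    3≤d₄
  where
  sum≡4n : sum (tabulate d) + 6 ≡ 4 * (5 + m)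
  sum≡4n = begin
    sum (tabulate d) + 6  ≡⟨ cong (_+ 6) (trans (sym (total≡sum-tabulate d)) total≡) ⟩
    4 * (4 + m) ∸ 2 + 6   ≡⟨ 4[n-1]-2+6≡4n m ⟩
    4 * (5 + m)           ∎
    where open ≡-Reasoning
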